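{- For every integer $n\ge2$, $\mathsf{PHP}^{n+1}_n\equiv\mathsf{id}_{\binom{n+1}{2}}$.
   Context: A number $N\ge1$ is identified with $\{0,\dots,N-1\}$. A (finite) problem $\mathsf{P}$ consists of a nonempty finite set of instances and, for each instance $x$, a nonempty finite set $\mathsf{P}(x)$ of solutions. For finite problems, $\mathsf{P}\le\mathsf{Q}$ if there exist a map $\Phi$ sending each $\mathsf{P}$-instance $x$ to a $\mathsf{Q}$-instance and a (partial) map $\Psi$ on $\mathsf{Q}$-solutions such that $\Psi(y)\in\mathsf{P}(x)$ whenever $y\in\mathsf{Q}(\Phi(x))$; $\mathsf{P}\equiv\mathsf{Q}$ means both $\mathsf{P}\le\mathsf{Q}$ and $\mathsf{Q}\le\mathsf{P}$. For $m>n\ge2$, $\mathsf{PHP}^m_n$ has as instances all functions $f:m\to n$, with solutions all unordered pairs $\{i,j\}$, $i\ne j$, $f(i)=f(j)$. For $k\ge1$, $\mathsf{id}_k$ has instances $j\in\{1,\dots,k\}$, each instance $j$ having unique solution $j$. -}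

module Defs where

open import Data.Nat using (ℕ; suc; _≤_)
open import Data.Nat.Combinatorics using (_C_)
open import Data.Fin using (Fin; _<_)
open import Data.Product using (Σ; _×_; _,_)
open import Data.Maybe using (Maybe; just)
open import Relation.Binary.PropositionalEquality using (_≡_)
open import Level using (0ℓ)

record Problem : Set₁ where
  field
    Inst : Set
    Sol  : Set
    _solves_ : Sol → Inst → Set
open Problem public

record _≤P_ (P Q : Problem) : Set where
  field
    Φ : Inst P → Inst Q
    Ψ : Sol Q → Maybe (Sol P)
    correct : ∀ (x : Inst P) (y : Sol Q) → _solves_ Q y (Φ x) →
              Σ (Sol P) λ s → (Ψ y ≡ just s) × _solves_ P s x

_≡P_ : Problem → Problem → Set
P ≡P Q = (P ≤P Q) × (Q ≤P P)

-- PHP^m_n : instances f : m → n; solutions unordered pairs {i,j}, i ≠ j,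
-- f i = f j, encoded canonically as ordered pairs (i , j) with i < j.
PHP : ℕ → ℕ → Problem
PHP m n = record
  { Inst = Fin m → Fin n
  ; Sol  = Fin m × Fin m
  ; _solves_ = λ { (i , j) f → (i < j) × (f i ≡ f j) }
  }

idP : ℕ → Problem
idP k = record
  { Inst = Fin k
  ; Sol  = Fin k
  ; _solves_ = λ s j → s ≡ j
  }

-- Pigeonhole gives every f : n+1 → n a collision, and the C(n+1,2) pairs i < j can be
-- enumerated, so f is reduced to id by sending it to the index of one of its collisions.
-- Conversely, for a < b the map that sends b to the image of a and is injective otherwise
-- has {a,b} as its only collision, so reading off the index of that collision solves id.
module Submission where

open import Defs
open import Data.Nat as ℕ using (ℕ; suc; _≤_; _+_; z≤n; s≤s)
open import Data.Nat.Combinatorics using (_C_; nC1≡n; nCk+nC[k+1]≡[n+1]C[k+1])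
open import Data.Nat.Properties using (n<1+n)
open import Data.Fin using (Fin; zero; suc; _<_; _↑ˡ_; _↑ʳ_; splitAt; punchOut; _≟_)
open import Data.Fin.Properties
  using (<-irrefl; <-trans; <⇒≢; _<?_; splitAt-↑ˡ; splitAt-↑ʳ; splitAt⁻¹-↑ˡ; splitAt⁻¹-↑ʳ; punchOut-injective; pigeonhole)
open import Data.Product using (_×_; _,_; proj₁; proj₂)
import Data.Product as Product
open import Data.Sum using (inj₁; inj₂)
open import Data.Maybe using (Maybe; just; nothing)
open import Function using (_∘_)
open import Relation.Binary.PropositionalEquality using (_≡_; _≢_; refl; sym; trans; cong; cong₂; subst; module ≡-Reasoning)
open import Relation.Nullary using (yes; no)
open import Relation.Nullary.Negation using (contradiction)

triangle : ℕ → ℕ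
triangle 0       = 0
triangle (suc m) = m + triangle m

triangle≡C2 : ∀ m → triangle m ≡ m C 2
triangle≡C2 0       = refl
triangle≡C2 (suc m) = begin
  m + triangle m    ≡⟨ cong₂ _+_ (sym (nC1≡n m)) (triangle≡C2 m) ⟩
  m C 1 + m C 2     ≡⟨ nCk+nC[k+1]≡[n+1]C[k+1] m 1 ⟩
  suc m C 2         ∎
  where open ≡-Reasoning

pairIndex : ∀ {m} (p : Fin m × Fin m) → proj₁ p < proj₂ p → Fin (triangle m)
pairIndex {suc m} (zero  , suc j) _         = j ↑ˡ triangle m
pairIndex {suc m} (suc i , suc j) (s≤s i<j) = m ↑ʳ pairIndex (i , j) i<j

indexPair : ∀ m → Fin (triangle m) → Fin m × Fin m
indexPair (suc m) k with splitAt m k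
... | inj₁ j = zero , suc j
... | inj₂ r = Product.map suc suc (indexPair m r)

indexPair-< : ∀ {m} (k : Fin (triangle m)) → proj₁ (indexPair m k) < proj₂ (indexPair m k)
indexPair-< {suc m} k with splitAt m k
... | inj₁ j = s≤s z≤n
... | inj₂ r = s≤s (indexPair-< r)

indexPair-pairIndex : ∀ {m} (p : Fin m × Fin m) (p< : proj₁ p < proj₂ p) → indexPair m (pairIndex p p<) ≡ p
indexPair-pairIndex {suc m} (zero  , suc j) _
  rewrite splitAt-↑ˡ m j (triangle m) = refl
indexPair-pairIndex {suc m} (suc i , suc j) (s≤s i<j)
  rewrite splitAt-↑ʳ m (triangle m) (pairIndex (i , j) i<j) | indexPair-pairIndex (i , j) i<j = refl

pairIndex-indexPair : ∀ {m} (k : Fin (triangle m)) (p< : proj₁ (indexPair m k) < proj₂ (indexPair m k)) →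
                      pairIndex (indexPair m k) p< ≡ k
pairIndex-indexPair {suc m} k p< with splitAt m k in eq
pairIndex-indexPair {suc m} k _         | inj₁ j = splitAt⁻¹-↑ˡ eq
pairIndex-indexPair {suc m} k (s≤s p<) | inj₂ r =
  trans (cong (m ↑ʳ_) (pairIndex-indexPair r p<)) (splitAt⁻¹-↑ʳ eq)

pairIndex? : ∀ {m} → Fin m × Fin m → Maybe (Fin (triangle m))
pairIndex? (i , j) with i <? j
... | yes i<j = just (pairIndex (i , j) i<j)
... | no _    = nothing

pairIndex?-indexPair : ∀ {m} (k : Fin (triangle m)) → pairIndex? (indexPair m k) ≡ just k
pairIndex?-indexPair {m} k with proj₁ (indexPair m k) <? proj₂ (indexPair m k)
... | yes p< = cong just (pairIndex-indexPair k p<)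
... | no p≮ = contradiction (indexPair-< k) p≮

merge : ∀ {n} {a b : Fin (suc n)} → a ≢ b → Fin (suc n) → Fin n
merge {b = b} a≢b x with x ≟ b
... | yes _    = punchOut (a≢b ∘ sym)
... | no x≢b = punchOut (x≢b ∘ sym)

merge-collision : ∀ {n} {a b x z : Fin (suc n)} (a<b : a < b) → x < z →
                  merge (<⇒≢ a<b) x ≡ merge (<⇒≢ a<b) z → (x , z) ≡ (a , b)
merge-collision {b = b} {x} {z} a<b x<z eq with x ≟ b | z ≟ b
... | yes refl | yes refl = contradiction x<z (<-irrefl refl)
... | yes refl | no _     = contradiction (<-trans a<b x<z) (<-irrefl (punchOut-injective {i = b} _ _ eq))
... | no _     | yes refl = cong (_, b) (punchOut-injective {i = b} _ _ eq)
... | no _     | no _     = contradiction x<z (<-irrefl (punchOut-injective {i = b} _ _ eq))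

≤P-idP : ∀ {P k} (select : Inst P → Fin k) (candidate : Fin k → Sol P) →
         (∀ x → _solves_ P (candidate (select x)) x) → P ≤P idP k
≤P-idP select candidate candidate-solves = record
  { Φ       = select
  ; Ψ       = just ∘ candidate
  ; correct = λ { x _ refl → candidate (select x) , refl , candidate-solves x }
  }

collisionIndex : ∀ {m n} → n ℕ.< m → (Fin m → Fin n) → Fin (triangle m)
collisionIndex n<m f = let (i , j , i<j , _) = pigeonhole n<m f in pairIndex (i , j) i<j

collisionIndex-solves : ∀ {m n} (n<m : n ℕ.< m) (f : Fin m → Fin n) →
                        _solves_ (PHP m n) (indexPair m (collisionIndex n<m f)) f
collisionIndex-solves n<m f with pigeonhole n<m f
... | i , j , i<j , fi≡fj rewrite indexPair-pairIndex (i , j) i<j = i<j , fi≡fj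

PHP≤idP : ∀ {m n} → n ℕ.< m → PHP m n ≤P idP (triangle m)
PHP≤idP {m} n<m = ≤P-idP (collisionIndex n<m) (indexPair m) (collisionIndex-solves n<m)

idP≤PHP : ∀ n → idP (triangle (suc n)) ≤P PHP (suc n) n
idP≤PHP n = record
  { Φ       = λ k → merge (<⇒≢ (indexPair-< k))
  ; Ψ       = pairIndex?
  ; correct = λ { k (x , z) (x<z , fx≡fz) → k , collision-index k x<z fx≡fz , refl }
  }
  where
  collision-index : ∀ k {x z} (x<z : x < z) → merge (<⇒≢ (indexPair-< k)) x ≡ merge (<⇒≢ (indexPair-< k)) z →
                    pairIndex? (x , z) ≡ just k
  collision-index k {x} {z} x<z fx≡fz = begin
    pairIndex? (x , z)              ≡⟨ cong pairIndex? (merge-collision (indexPair-< k) x<z fx≡fz) ⟩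
    pairIndex? (indexPair (suc n) k) ≡⟨ pairIndex?-indexPair k ⟩
    just k                          ∎
    where open ≡-Reasoning

proposition2p2 : ∀ (n : ℕ) → 2 ≤ n → PHP (suc n) n ≡P idP (suc n C 2)
proposition2p2 n _ = subst (λ k → PHP (suc n) n ≡P idP k) (triangle≡C2 (suc n)) (PHP≤idP (n<1+n n) , idP≤PHP n)
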